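{- Let $r\ge 2$, let $\sigma$ be an $r$-signotope on $[n]$ and let $I$ be an $(r-1)$-subset of $[n]$. Then there is an $r$-signotope $\sigma^*$ on $[n+1]$ such that $I\cup\{n+1\}$ is a fliple of $\sigma^*$ and $\sigma^*\setminus\!\!\setminus(n+1)=\sigma$.
   Context: An $r$-signotope on $[n]$ is a map $\sigma:\binom{[n]}{r}\to\{+,-\}$ such that for every $(r+1)$-subset $X=\{x_1<\dots<x_{r+1}\}$ the sequence $\sigma(X_1),\dots,\sigma(X_{r+1})$ has at most one sign change, where $X_j=X\setminus\{x_j\}$. An $r$-subset $F$ is a fliple of $\sigma$ if both assignments $+$ and $-$ to $\sigma(F)$ (keeping all other values) yield an $r$-signotope. The deletion $\sigma^*\setminus\!\!\setminus(n+1)$ of a signotope $\sigma^*$ on $[n+1]$ is its restriction to $r$-subsets of $[n]$. -}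

module Defs where

open import Data.Nat using (ℕ; zero; suc; _+_; _≤_)
open import Data.Bool using (Bool; true; false; if_then_else_)
open import Data.Fin using (Fin; _<_; inject₁; fromℕ)
open import Data.Vec using (Vec; lookup; removeAt; map; _∷ʳ_)
open import Data.Vec.Properties using (≡-dec)
open import Data.Fin.Properties using (_≟_)
open import Data.List using (List; []; _∷_)
open import Data.List using () renaming (map to lmap)
open import Data.List using (allFin)
open import Relation.Binary.PropositionalEquality using (_≡_)
open import Relation.Nullary using (Dec; yes; no; does)

-- Signs: true = +, false = -.
Sign : Set
Sign = Bool

-- [n] is modelled as Fin n (0-indexed: element i of Fin n is i+1 of [n]);
-- the new element n+1 of [n+1] is  fromℕ n : Fin (suc n).
-- An r-subset of [n] is a strictly increasing vector of length r.
Increasing : ∀ {n r} → Vec (Fin n) r → Set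
Increasing v = ∀ i j → i < j → lookup v i < lookup v j

-- A sign assignment on r-subsets of [n]: a function on length-r vectors;
-- only its values on strictly increasing vectors (= r-subsets) matter.
SignMap : ℕ → ℕ → Set
SignMap r n = Vec (Fin n) r → Sign

changes : List Sign → ℕ
changes [] = 0
changes (a ∷ []) = 0
changes (a ∷ b ∷ l) = (if does (a Data.Bool.≟ b) then 0 else 1) + changes (b ∷ l)

IsSignotope : ∀ {r n} → SignMap r n → Set
IsSignotope {r} {n} σ =
  (X : Vec (Fin n) (suc r)) → Increasing X →
  changes (lmap (λ j → σ (removeAt X j)) (allFin (suc r))) ≤ 1

update : ∀ {r n} → SignMap r n → Vec (Fin n) r → Sign → SignMap r n
update σ F s v with ≡-dec _≟_ v F
... | yes _ = s
... | no _ = σ v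

IsFliple : ∀ {r n} → SignMap r n → Vec (Fin n) r → Set
IsFliple σ F = IsSignotope (update σ F true) Data.Product.× IsSignotope (update σ F false)
  where import Data.Product

deletion : ∀ {r n} → SignMap r (suc n) → SignMap r n
deletion σ* v = σ* (map inject₁ v)

addTop : ∀ {k n} → Vec (Fin n) k → Vec (Fin (suc n)) (suc k)
addTop {n = n} I = map inject₁ I ∷ʳ fromℕ n

{-# OPTIONS --safe #-}
module Submission where

-- A sign map σ* on [n+1] is determined by its deletion σ and its contraction τ(Y) = σ*(Y ∪ {n+1}),
-- and σ* is a signotope iff σ is one and, for every r-subset Y of [n], the sequence
-- τ(Y_1), …, τ(Y_r), σ(Y) changes sign at most once, i.e. once the packet of Y has reached the sign
-- σ(Y) it keeps it. Every signotope σ has a height function φ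
-- on (r−1)-subsets that strictly decreases along the packet of each Y with σ(Y) = + and strictly
-- increases when σ(Y) = −; it is built by induction on n, stacking heights of the deletion and of
-- the contraction of σ in three bands. Then τ(G) = [φ(G) < φ(I)] is compatible with σ, and it stays
-- compatible whatever value is put at G = I, so I ∪ {n+1} is a fliple of the extension.

open import Defs
open import Data.Nat using (ℕ; zero; suc; _+_; _*_; _^_; _≤_; z≤n; s≤s; z<s; _<?_) renaming (_<_ to _<ℕ_)
open import Data.Nat.Properties
  using ( ≤-trans; ≤-reflexive; <-≤-trans; <-trans; <-irrefl; <-asym; <⇒≱
        ; +-monoʳ-≤; +-monoʳ-<; +-identityʳ; m≤m+n; m≤n+m; m^n>0)
open import Data.Bool using (true; false; if_then_else_)
open import Data.Bool.Properties using (¬-not) renaming (_≟_ to _≟ᵇ_)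
open import Data.Fin using (Fin; zero; suc; _<_; inject₁; fromℕ)
open import Data.Fin.Properties using (_≟_; toℕ-inject₁; toℕ-fromℕ; ≤fromℕ; inject₁ℕ<)
open import Data.Vec using (Vec; []; _∷_; lookup; removeAt; map; _∷ʳ_)
open import Data.Vec.Properties using (≡-dec)
open import Data.Vec.Relation.Unary.All using (All; []; _∷_)
import Data.Vec.Relation.Unary.All as All
import Data.Vec.Relation.Unary.All.Properties as All
open import Data.Vec.Relation.Unary.AllPairs using (AllPairs; []; _∷_)
import Data.Vec.Relation.Unary.AllPairs as AllPairs
import Data.Vec.Relation.Unary.AllPairs.Properties as AllPairs
open import Data.List as List using (List; tabulate) renaming (_∷_ to _∷ₗ_; _∷ʳ_ to _∷ʳₗ_)
open import Data.List.Properties using (tabulate-cong; map-tabulate)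
open import Data.Maybe using (just; nothing)
open import Data.Maybe.Properties using (just-injective)
open import Data.Product using (Σ; Σ-syntax; _×_; _,_; proj₁; proj₂)
open import Function using (id; _∘_; const)
open import Relation.Binary.PropositionalEquality
  using (_≡_; _≢_; _≗_; refl; sym; trans; cong; cong₂; subst; subst₂; module ≡-Reasoning)
open import Relation.Nullary using (¬_; Dec; yes; no; does; contradiction)
open import Relation.Nullary.Decidable using (dec-true)

private
  variable
    A : Set
    k n r : ℕ

-- Vectors over [n+1] and the new element n+1

Increasing⇒AllPairs : {v : Vec (Fin n) r} → Increasing v → AllPairs _<_ v
Increasing⇒AllPairs {v = []} _ = []
Increasing⇒AllPairs {v = x ∷ v} v↑ =
  All.lookup⁻ (λ j → v↑ zero (suc j) z<s) ∷
  Increasing⇒AllPairs (λ i j i<j → v↑ (suc i) (suc j) (s≤s i<j))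

AllPairs⇒Increasing : {v : Vec (Fin n) r} → AllPairs _<_ v → Increasing v
AllPairs⇒Increasing (x<v ∷ _) zero (suc j) _ = All.lookup⁺ x<v j
AllPairs⇒Increasing (_ ∷ v↑) (suc i) (suc j) (s≤s i<j) = AllPairs⇒Increasing v↑ i j i<j

Increasing-∷ : {x : Fin n} {xs : Vec (Fin n) r} → All (x <_) xs → Increasing xs → Increasing (x ∷ xs)
Increasing-∷ x<xs xs↑ = AllPairs⇒Increasing (x<xs ∷ Increasing⇒AllPairs xs↑)

All-∷ʳ⁺ : {P : A → Set} {xs : Vec A r} {x : A} → All P xs → P x → All P (xs ∷ʳ x)
All-∷ʳ⁺ [] px = px ∷ []
All-∷ʳ⁺ (py ∷ pys) px = py ∷ All-∷ʳ⁺ pys px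

All-∷ʳ⁻ : {P : A → Set} {xs : Vec A r} {x : A} → All P (xs ∷ʳ x) → All P xs
All-∷ʳ⁻ {xs = []} _ = []
All-∷ʳ⁻ {xs = _ ∷ _} (py ∷ pys) = py ∷ All-∷ʳ⁻ pys

AllPairs-∷ʳ⁺ : {R : A → A → Set} {xs : Vec A r} {x : A} →
  AllPairs R xs → All (λ y → R y x) xs → AllPairs R (xs ∷ʳ x)
AllPairs-∷ʳ⁺ [] [] = [] ∷ []
AllPairs-∷ʳ⁺ (Ryys ∷ ys↑) (Ryx ∷ Rysx) = All-∷ʳ⁺ Ryys Ryx ∷ AllPairs-∷ʳ⁺ ys↑ Rysx

removeAt-map : {B : Set} (f : A → B) (xs : Vec A (suc r)) (i : Fin (suc r)) →
  removeAt (map f xs) i ≡ map f (removeAt xs i)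
removeAt-map f (x ∷ xs) zero = refl
removeAt-map f (x ∷ y ∷ xs) (suc i) = cong (f x ∷_) (removeAt-map f (y ∷ xs) i)

removeAt-∷ʳ-inject₁ : (xs : Vec A (suc r)) (x : A) (i : Fin (suc r)) →
  removeAt (xs ∷ʳ x) (inject₁ i) ≡ removeAt xs i ∷ʳ x
removeAt-∷ʳ-inject₁ (y ∷ []) x zero = refl
removeAt-∷ʳ-inject₁ (y ∷ z ∷ ys) x zero = refl
removeAt-∷ʳ-inject₁ (y ∷ z ∷ ys) x (suc i) = cong (y ∷_) (removeAt-∷ʳ-inject₁ (z ∷ ys) x i)

removeAt-∷ʳ-fromℕ : (xs : Vec A r) (x : A) → removeAt (xs ∷ʳ x) (fromℕ r) ≡ xs
removeAt-∷ʳ-fromℕ [] x = refl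
removeAt-∷ʳ-fromℕ (y ∷ []) x = refl
removeAt-∷ʳ-fromℕ (y ∷ z ∷ ys) x = cong (y ∷_) (removeAt-∷ʳ-fromℕ (z ∷ ys) x)

inject₁-< : {i j : Fin n} → i < j → inject₁ i < inject₁ j
inject₁-< {i = i} {j} i<j rewrite toℕ-inject₁ i | toℕ-inject₁ j = i<j

inject₁-<⁻ : {i j : Fin n} → inject₁ i < inject₁ j → i < j
inject₁-<⁻ {i = i} {j} i<j rewrite toℕ-inject₁ i | toℕ-inject₁ j = i<j

inject₁<fromℕ : (i : Fin n) → inject₁ i < fromℕ n
inject₁<fromℕ {n} i rewrite toℕ-fromℕ n = inject₁ℕ< i

Increasing-inject₁ : (W : Vec (Fin n) r) → Increasing W → Increasing (map inject₁ W)
Increasing-inject₁ W W↑ =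
  AllPairs⇒Increasing (AllPairs.map⁺ {xs = W} (AllPairs.map inject₁-< (Increasing⇒AllPairs W↑)))

Increasing-addTop : (Y : Vec (Fin n) r) → Increasing Y → Increasing (addTop Y)
Increasing-addTop Y Y↑ = AllPairs⇒Increasing
  (AllPairs-∷ʳ⁺ (AllPairs.map⁺ {xs = Y} (AllPairs.map inject₁-< (Increasing⇒AllPairs Y↑)))
               (All.map⁺ {xs = Y} (All.lookup⁻ (inject₁<fromℕ ∘ lookup Y))))

removeAt-addTop-inject₁ : (Y : Vec (Fin n) (suc r)) (i : Fin (suc r)) →
  removeAt (addTop Y) (inject₁ i) ≡ addTop (removeAt Y i)
removeAt-addTop-inject₁ {n} Y i =
  trans (removeAt-∷ʳ-inject₁ (map inject₁ Y) (fromℕ n) i) (cong (_∷ʳ fromℕ n) (removeAt-map inject₁ Y i))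

data TopOrInject₁ : Fin (suc n) → Set where
  top    : TopOrInject₁ (fromℕ n)
  inject : (i : Fin n) → TopOrInject₁ (inject₁ i)

topOrInject₁ : (i : Fin (suc n)) → TopOrInject₁ i
topOrInject₁ {zero} zero = top
topOrInject₁ {suc n} zero = inject zero
topOrInject₁ {suc n} (suc i) with topOrInject₁ i
... | top = top
... | inject j = inject (suc j)

topOrInject₁-fromℕ : ∀ n → topOrInject₁ (fromℕ n) ≡ top
topOrInject₁-fromℕ zero = refl
topOrInject₁-fromℕ (suc n) rewrite topOrInject₁-fromℕ n = refl

topOrInject₁-inject₁ : (i : Fin n) → topOrInject₁ (inject₁ i) ≡ inject i
topOrInject₁-inject₁ {suc n} zero = refl
topOrInject₁-inject₁ {suc n} (suc i) rewrite topOrInject₁-inject₁ i = refl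

data TopSplit : Vec (Fin (suc n)) (suc r) → Set where
  avoids   : (W : Vec (Fin n) (suc r)) → Increasing W → TopSplit (map inject₁ W)
  contains : (Y : Vec (Fin n) r) → Increasing Y → TopSplit (addTop Y)

fromℕ-≮ : {xs : Vec (Fin (suc n)) (suc r)} → ¬ All (fromℕ n <_) xs
fromℕ-≮ {xs = xs} top<xs = <⇒≱ (All.lookup⁺ top<xs zero) (≤fromℕ (lookup xs zero))

topSplit-∷ : ∀ x {xs : Vec (Fin (suc n)) (suc r)} → All (x <_) xs → TopSplit xs → TopSplit (x ∷ xs)
topSplit-∷ x x<W (avoids W W↑) with topOrInject₁ x
... | top = contradiction x<W fromℕ-≮
... | inject i = avoids (i ∷ W) (Increasing-∷ (All.map inject₁-<⁻ (All.map⁻ x<W)) W↑)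
topSplit-∷ x x<Y (contains Y Y↑) with topOrInject₁ x
... | top = contradiction x<Y fromℕ-≮
... | inject i = contains (i ∷ Y) (Increasing-∷ (All.map inject₁-<⁻ (All.map⁻ (All-∷ʳ⁻ x<Y))) Y↑)

topSplit : {X : Vec (Fin (suc n)) (suc r)} → Increasing X → TopSplit X
topSplit {X = x ∷ []} _ with topOrInject₁ x
... | top = contains [] λ ()
... | inject i = avoids (i ∷ []) λ { zero zero () ; zero (suc ()) _ ; (suc ()) _ _ }
topSplit {X = x ∷ y ∷ xs} X↑ =
  topSplit-∷ x (AllPairs.head {xs = x ∷ y ∷ xs} (Increasing⇒AllPairs X↑))
    (topSplit (λ i j i<j → X↑ (suc i) (suc j) (s≤s i<j)))

-- Reads a vector over [n+1] either as W ⊆ [n], giving f W, or as Y ∪ {n+1}, giving g Y;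
-- any other vector (n+1 not in last position) gets the default d.
glue : A → (Vec (Fin n) (suc k) → A) → (Vec (Fin n) k → A) → Vec (Fin (suc n)) (suc k) → A
glue d f g (x ∷ []) with topOrInject₁ x
... | top = g []
... | inject i = f (i ∷ [])
glue d f g (x ∷ y ∷ xs) with topOrInject₁ x
... | top = d
... | inject i = glue d (f ∘ (i ∷_)) (g ∘ (i ∷_)) (y ∷ xs)

module _ {d : A} where

  glue-inject₁-∷ : {f : Vec (Fin n) (suc (suc k)) → A} {g : Vec (Fin n) (suc k) → A} →
    ∀ i (xs : Vec (Fin (suc n)) (suc k)) →
    glue d f g (inject₁ i ∷ xs) ≡ glue d (f ∘ (i ∷_)) (g ∘ (i ∷_)) xs
  glue-inject₁-∷ i (_ ∷ _) rewrite topOrInject₁-inject₁ i = refl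

  glue-inject₁ : {f : Vec (Fin n) (suc k) → A} {g : Vec (Fin n) k → A} →
    ∀ W → glue d f g (map inject₁ W) ≡ f W
  glue-inject₁ (w ∷ []) rewrite topOrInject₁-inject₁ w = refl
  glue-inject₁ (w ∷ w′ ∷ W) =
    trans (glue-inject₁-∷ w (map inject₁ (w′ ∷ W))) (glue-inject₁ (w′ ∷ W))

  glue-addTop : {f : Vec (Fin n) (suc k) → A} {g : Vec (Fin n) k → A} →
    ∀ Y → glue d f g (addTop Y) ≡ g Y
  glue-addTop {n = n} [] rewrite topOrInject₁-fromℕ n = refl
  glue-addTop (y ∷ Y) = trans (glue-inject₁-∷ y (addTop Y)) (glue-addTop Y)

  glue-elim : (P : A → Set) {f : Vec (Fin n) (suc k) → A} {g : Vec (Fin n) k → A} →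
    P d → (∀ W → P (f W)) → (∀ Y → P (g Y)) → ∀ X → P (glue d f g X)
  glue-elim P pd pf pg (x ∷ []) with topOrInject₁ x
  ... | top = pg []
  ... | inject i = pf (i ∷ [])
  glue-elim P pd pf pg (x ∷ y ∷ xs) with topOrInject₁ x
  ... | top = pd
  ... | inject i = glue-elim P pd (pf ∘ (i ∷_)) (pg ∘ (i ∷_)) (y ∷ xs)

addTop-injective : {Y Y′ : Vec (Fin n) k} → addTop Y ≡ addTop Y′ → Y ≡ Y′
addTop-injective {Y = Y} {Y′} eq = just-injective (begin
  just Y             ≡⟨ glue-addTop Y ⟨
  decode (addTop Y)  ≡⟨ cong decode eq ⟩
  decode (addTop Y′) ≡⟨ glue-addTop Y′ ⟩
  just Y′            ∎)
  where
  open ≡-Reasoning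
  decode = glue nothing (const nothing) just

inject₁≢addTop : (W : Vec (Fin n) (suc k)) (Y : Vec (Fin n) k) → map inject₁ W ≢ addTop Y
inject₁≢addTop W Y eq
  with trans (sym (glue-inject₁ W)) (trans (cong (glue false (const false) (const true)) eq) (glue-addTop Y))
... | ()

-- Sign changes

signChange : Sign → Sign → ℕ
signChange a b = if does (a ≟ᵇ b) then 0 else 1

AtMostOneChange : List Sign → Set
AtMostOneChange l = changes l ≤ 1

signChange≤1 : ∀ x y → signChange x y ≤ 1
signChange≤1 false false = z≤n
signChange≤1 false true  = s≤s z≤n
signChange≤1 true  false = s≤s z≤n
signChange≤1 true  true  = z≤n

signChange-triangle : ∀ x y z → signChange x z ≤ signChange x y + signChange y z
signChange-triangle false _     false = z≤n
signChange-triangle true  _     true  = z≤n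
signChange-triangle false false true  = s≤s z≤n
signChange-triangle false true  true  = s≤s z≤n
signChange-triangle true  false false = s≤s z≤n
signChange-triangle true  true  false = s≤s z≤n

signChange-absorbing : ∀ x y z → (x ≡ z → y ≡ z) → signChange x y + signChange y z ≤ signChange x z
signChange-absorbing false false false _ = z≤n
signChange-absorbing true  true  true  _ = z≤n
signChange-absorbing false false true  _ = s≤s z≤n
signChange-absorbing false true  true  _ = s≤s z≤n
signChange-absorbing true  false false _ = s≤s z≤n
signChange-absorbing true  true  false _ = s≤s z≤n
signChange-absorbing false true  false x→y = contradiction (x→y refl) λ ()
signChange-absorbing true  false true  x→y = contradiction (x→y refl) λ ()

signChange-return : ∀ x y → signChange x y + signChange y x ≤ 1 → y ≡ x
signChange-return false false _ = refl
signChange-return true  true  _ = refl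
signChange-return false true  (s≤s ())
signChange-return true  false (s≤s ())

changes-mono-∷ʳ : (l : List Sign) (b : Sign) → changes l ≤ changes (l ∷ʳₗ b)
changes-mono-∷ʳ List.[] _ = z≤n
changes-mono-∷ʳ (_ ∷ₗ List.[]) _ = z≤n
changes-mono-∷ʳ (x ∷ₗ y ∷ₗ l) b = +-monoʳ-≤ (signChange x y) (changes-mono-∷ʳ (y ∷ₗ l) b)

tabulate-∷ʳ : (f : Fin (suc r) → A) → tabulate f ≡ tabulate (f ∘ inject₁) ∷ʳₗ f (fromℕ r)
tabulate-∷ʳ {zero} f = refl
tabulate-∷ʳ {suc r} f = cong (f zero ∷ₗ_) (tabulate-∷ʳ (f ∘ suc))

Absorbing : Sign → (Fin (suc r) → Sign) → Set
Absorbing {r} b g = (t : Fin r) → g (inject₁ t) ≡ b → g (suc t) ≡ b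

signChange≤changes : (g : Fin (suc r) → Sign) (b : Sign) → signChange (g zero) b ≤ changes (tabulate g ∷ʳₗ b)
signChange≤changes {zero} g b = ≤-reflexive (sym (+-identityʳ _))
signChange≤changes {suc r} g b =
  ≤-trans (signChange-triangle (g zero) (g (suc zero)) b) (+-monoʳ-≤ _ (signChange≤changes (g ∘ suc) b))

absorbing⇒changes≤signChange : (g : Fin (suc r) → Sign) (b : Sign) → Absorbing b g →
  changes (tabulate g ∷ʳₗ b) ≤ signChange (g zero) b
absorbing⇒changes≤signChange {zero} g b _ = ≤-reflexive (+-identityʳ _)
absorbing⇒changes≤signChange {suc r} g b absorb =
  ≤-trans (+-monoʳ-≤ _ (absorbing⇒changes≤signChange (g ∘ suc) b (absorb ∘ suc)))
          (signChange-absorbing _ _ b (absorb zero))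

absorbing⇒atMostOneChange : (g : Fin (suc r) → Sign) (b : Sign) →
  Absorbing b g → AtMostOneChange (tabulate g ∷ʳₗ b)
absorbing⇒atMostOneChange g b absorb =
  ≤-trans (absorbing⇒changes≤signChange g b absorb) (signChange≤1 (g zero) b)

atMostOneChange⇒absorbing : (g : Fin (suc r) → Sign) (b : Sign) →
  AtMostOneChange (tabulate g ∷ʳₗ b) → Absorbing b g
atMostOneChange⇒absorbing {suc r} g b ≤1 zero g₀≡b =
  signChange-return b (g (suc zero))
    (subst (λ x → signChange x (g (suc zero)) + signChange (g (suc zero)) b ≤ 1) g₀≡b
           (≤-trans (+-monoʳ-≤ _ (signChange≤changes (g ∘ suc) b)) ≤1))
atMostOneChange⇒absorbing {suc r} g b ≤1 (suc t) =
  atMostOneChange⇒absorbing (g ∘ suc) b (≤-trans (m≤n+m _ _) ≤1) t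

-- Deletion and contraction

facetSigns : SignMap r n → Vec (Fin n) (suc r) → List Sign
facetSigns σ X = tabulate (λ j → σ (removeAt X j))

isSignotope⁻ : {σ : SignMap r n} → IsSignotope σ → ∀ X → Increasing X → AtMostOneChange (facetSigns σ X)
isSignotope⁻ {σ = σ} σ-sig X X↑ =
  subst AtMostOneChange (map-tabulate id (λ j → σ (removeAt X j))) (σ-sig X X↑)

isSignotope⁺ : {σ : SignMap r n} → (∀ X → Increasing X → AtMostOneChange (facetSigns σ X)) → IsSignotope σ
isSignotope⁺ {σ = σ} facets X X↑ =
  subst AtMostOneChange (sym (map-tabulate id (λ j → σ (removeAt X j)))) (facets X X↑)

IsSignotope-resp-≗ : {σ σ′ : SignMap r n} → σ ≗ σ′ → IsSignotope σ → IsSignotope σ′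
IsSignotope-resp-≗ {σ = σ} {σ′} σ≗σ′ σ-sig = isSignotope⁺ {σ = σ′} λ X X↑ →
  subst AtMostOneChange (tabulate-cong (λ j → σ≗σ′ (removeAt X j))) (isSignotope⁻ {σ = σ} σ-sig X X↑)

contraction : SignMap (suc k) (suc n) → SignMap k n
contraction σ Y = σ (addTop Y)

Compatible : SignMap (suc k) n → SignMap k n → Set
Compatible σ τ = ∀ Y → Increasing Y → Absorbing (σ Y) (λ j → τ (removeAt Y j))

facetSigns-inject₁ : (σ : SignMap r (suc n)) (W : Vec (Fin n) (suc r)) →
  facetSigns σ (map inject₁ W) ≡ facetSigns (deletion σ) W
facetSigns-inject₁ σ W = tabulate-cong (cong σ ∘ removeAt-map inject₁ W)

facetSigns-addTop : (σ : SignMap (suc k) (suc n)) (Y : Vec (Fin n) (suc k)) →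
  facetSigns σ (addTop Y) ≡ facetSigns (contraction σ) Y ∷ʳₗ deletion σ Y
facetSigns-addTop {n = n} σ Y = begin
  facetSigns σ (addTop Y)
    ≡⟨ tabulate-∷ʳ (λ j → σ (removeAt (addTop Y) j)) ⟩
  tabulate (λ j → σ (removeAt (addTop Y) (inject₁ j))) ∷ʳₗ σ (removeAt (addTop Y) (fromℕ _))
    ≡⟨ cong₂ _∷ʳₗ_ (tabulate-cong (cong σ ∘ removeAt-addTop-inject₁ Y))
                   (cong σ (removeAt-∷ʳ-fromℕ (map inject₁ Y) (fromℕ n))) ⟩
  facetSigns (contraction σ) Y ∷ʳₗ deletion σ Y ∎
  where open ≡-Reasoning

module _ {σ : SignMap (suc k) (suc n)} where

  deletion-isSignotope : IsSignotope σ → IsSignotope (deletion σ)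
  deletion-isSignotope σ-sig = isSignotope⁺ {σ = deletion σ} λ W W↑ →
    subst AtMostOneChange (facetSigns-inject₁ σ W)
      (isSignotope⁻ {σ = σ} σ-sig (map inject₁ W) (Increasing-inject₁ W W↑))

  addTop-atMostOneChange : IsSignotope σ → ∀ Y → Increasing Y →
    AtMostOneChange (facetSigns (contraction σ) Y ∷ʳₗ deletion σ Y)
  addTop-atMostOneChange σ-sig Y Y↑ =
    subst AtMostOneChange (facetSigns-addTop σ Y) (isSignotope⁻ {σ = σ} σ-sig (addTop Y) (Increasing-addTop Y Y↑))

  contraction-compatible : IsSignotope σ → Compatible (deletion σ) (contraction σ)
  contraction-compatible σ-sig Y Y↑ =
    atMostOneChange⇒absorbing (λ j → contraction σ (removeAt Y j)) (deletion σ Y)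
      (addTop-atMostOneChange σ-sig Y Y↑)

  contraction-isSignotope : IsSignotope σ → IsSignotope (contraction σ)
  contraction-isSignotope σ-sig = isSignotope⁺ {σ = contraction σ} λ Y Y↑ →
    ≤-trans (changes-mono-∷ʳ (facetSigns (contraction σ) Y) (deletion σ Y)) (addTop-atMostOneChange σ-sig Y Y↑)

  isSignotope-from-parts : IsSignotope (deletion σ) → Compatible (deletion σ) (contraction σ) → IsSignotope σ
  isSignotope-from-parts del-sig compat = isSignotope⁺ {σ = σ} λ X X↑ → facets (topSplit {X = X} X↑)
    where
    facets : {X : Vec (Fin (suc n)) (suc (suc k))} → TopSplit X → AtMostOneChange (facetSigns σ X)
    facets (avoids W W↑) =
      subst AtMostOneChange (sym (facetSigns-inject₁ σ W)) (isSignotope⁻ {σ = deletion σ} del-sig W W↑)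
    facets (contains Y Y↑) =
      subst AtMostOneChange (sym (facetSigns-addTop σ Y))
        (absorbing⇒atMostOneChange (λ j → contraction σ (removeAt Y j)) (deletion σ Y) (compat Y Y↑))

-- Potentials

Oriented : Sign → ℕ → ℕ → Set
Oriented true  x y = y <ℕ x
Oriented false x y = x <ℕ y

IsPotential : SignMap (suc k) n → (Vec (Fin n) k → ℕ) → Set
IsPotential σ φ =
  ∀ Y → Increasing Y → ∀ t → Oriented (σ Y) (φ (removeAt Y (inject₁ t))) (φ (removeAt Y (suc t)))

Potential : SignMap (suc k) n → Set
Potential {k} {n} σ = Σ[ φ ∈ (Vec (Fin n) k → ℕ) ] (∀ G → φ G <ℕ 3 ^ n) × IsPotential σ φ

Oriented-+ : ∀ s c {x y} → Oriented s x y → Oriented s (c + x) (c + y)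
Oriented-+ true  c = +-monoʳ-< c
Oriented-+ false c = +-monoʳ-< c

-- For heights x < M: the bottom band [0, M) for sign +, the top band [2M, 3M) for sign −.
band : Sign → ℕ → ℕ → ℕ
band s M x = if s then x else M + (M + x)

band<3M : ∀ s {M x} → x <ℕ M → band s M x <ℕ 3 * M
band<3M true  {M} x<M = <-≤-trans x<M (m≤m+n M _)
band<3M false {M} {x} x<M = +-monoʳ-< M (+-monoʳ-< M (subst (x <ℕ_) (sym (+-identityʳ M)) x<M))

middle<3M : ∀ {M y} → y <ℕ M → M + y <ℕ 3 * M
middle<3M {M} y<M = +-monoʳ-< M (<-≤-trans y<M (m≤m+n M _))

band-middle : ∀ s {M x y} → x <ℕ M → y <ℕ M → Oriented s (M + y) (band s M x)
band-middle true  {M} {y = y} x<M _ = <-≤-trans x<M (m≤m+n M y)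
band-middle false {M} {x} x<M y<M = +-monoʳ-< M (<-≤-trans y<M (m≤m+n M x))

band-step : ∀ s s′ b {M x y} → x <ℕ M → y <ℕ M → Oriented b x y → (s ≡ b → s′ ≡ b) →
  Oriented b (band s M x) (band s′ M y)
band-step true  true  b _ _ x→y _ = x→y
band-step false false b {M} _ _ x→y _ = Oriented-+ b M (Oriented-+ b M x→y)
band-step true  false false {M} x<M _ _ _ = <-≤-trans x<M (m≤m+n M _)
band-step false true  true  {M} _ y<M _ _ = <-≤-trans y<M (m≤m+n M _)
band-step true  false true  _ _ _ s→s′ = contradiction (s→s′ refl) λ ()
band-step false true  false _ _ _ s→s′ = contradiction (s→s′ refl) λ ()

-- A set Y avoiding n+1 gets the deletion's height in the band of its contraction sign, and Y ∪ {n+1}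
-- the contraction's height in the middle band. Along a packet avoiding n+1 the band can only change
-- where the contraction signs change, which by compatibility is towards the sign of the packet.
stackPotentials : (σ : SignMap (suc (suc k)) (suc n)) → Compatible (deletion σ) (contraction σ) →
  Potential (deletion σ) → Potential (contraction σ) → Potential σ
stackPotentials {k} {n} σ compat (φᵈ , φᵈ<M , φᵈ-pot) (φᶜ , φᶜ<M , φᶜ-pot) = φ , φ<3M , φ-pot
  where
  M = 3 ^ n

  φ : Vec (Fin (suc n)) (suc k) → ℕ
  φ = glue 0 (λ W → band (contraction σ W) M (φᵈ W)) (λ Y → M + φᶜ Y)

  φ<3M : ∀ G → φ G <ℕ 3 * M
  φ<3M = glue-elim (_<ℕ 3 * M) (m^n>0 3 (suc n))
    (λ W → band<3M (contraction σ W) (φᵈ<M W)) (λ Y → middle<3M (φᶜ<M Y))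

  φ-inject₁ : ∀ Z j →
    φ (removeAt (map inject₁ Z) j) ≡ band (contraction σ (removeAt Z j)) M (φᵈ (removeAt Z j))
  φ-inject₁ Z j = trans (cong φ (removeAt-map inject₁ Z j)) (glue-inject₁ (removeAt Z j))

  φ-addTop : ∀ Z j → φ (removeAt (addTop Z) (inject₁ j)) ≡ M + φᶜ (removeAt Z j)
  φ-addTop Z j = trans (cong φ (removeAt-addTop-inject₁ Z j)) (glue-addTop (removeAt Z j))

  φ-addTop-last : ∀ Z → φ (removeAt (addTop Z) (fromℕ (suc k))) ≡ band (contraction σ Z) M (φᵈ Z)
  φ-addTop-last Z = trans (cong φ (removeAt-∷ʳ-fromℕ (map inject₁ Z) (fromℕ n))) (glue-inject₁ Z)

  oriented : {X : Vec (Fin (suc n)) (suc (suc k))} → TopSplit X → ∀ t →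
    Oriented (σ X) (φ (removeAt X (inject₁ t))) (φ (removeAt X (suc t)))
  oriented (avoids Z Z↑) t =
    subst₂ (Oriented (deletion σ Z)) (sym (φ-inject₁ Z (inject₁ t))) (sym (φ-inject₁ Z (suc t)))
      (band-step _ _ _ (φᵈ<M _) (φᵈ<M _) (φᵈ-pot Z Z↑ t) (compat Z Z↑ t))
  oriented (contains Z Z↑) t with topOrInject₁ t
  ... | inject t′ =
    subst₂ (Oriented (contraction σ Z)) (sym (φ-addTop Z (inject₁ t′))) (sym (φ-addTop Z (suc t′)))
      (Oriented-+ (contraction σ Z) M (φᶜ-pot Z Z↑ t′))
  ... | top =
    subst₂ (Oriented (contraction σ Z)) (sym (φ-addTop Z (fromℕ k))) (sym (φ-addTop-last Z))
      (band-middle (contraction σ Z) (φᵈ<M Z) (φᶜ<M _))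

  φ-pot : IsPotential σ φ
  φ-pot X X↑ = oriented (topSplit {X = X} X↑)

potential : (σ : SignMap (suc k) n) → IsSignotope σ → Potential σ
potential {n = zero} σ _ = const 0 , (λ _ → z<s) , λ { (() ∷ _) _ _ }
potential {zero} {suc n} σ _ = const 0 , (λ _ → m^n>0 3 (suc n)) , λ _ _ ()
potential {suc k} {suc n} σ σ-sig =
  stackPotentials σ (contraction-compatible {σ = σ} σ-sig)
    (potential (deletion σ) (deletion-isSignotope {σ = σ} σ-sig))
    (potential (contraction σ) (contraction-isSignotope {σ = σ} σ-sig))

-- Thresholds and fliples

DownClosed : (A → ℕ) → (A → Sign) → Set
DownClosed φ τ = ∀ a b → φ b <ℕ φ a → τ a ≡ true → τ b ≡ true

below : (A → ℕ) → ℕ → A → Sign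
below φ c a = does (φ a <? c)

module _ (φ : A → ℕ) (c : ℕ) where

  below⁺ : ∀ {a} → φ a <ℕ c → below φ c a ≡ true
  below⁺ {a} = dec-true (φ a <? c)

  below⁻ : ∀ a → below φ c a ≡ true → φ a <ℕ c
  below⁻ a = witness (φ a <? c)
    where
    witness : (φa<?c : Dec (φ a <ℕ c)) → does φa<?c ≡ true → φ a <ℕ c
    witness (yes φa<c) _ = φa<c

  below-downClosed : DownClosed φ (below φ c)
  below-downClosed a _ φb<φa τa = below⁺ (<-trans φb<φa (below⁻ a τa))

downClosed⇒compatible : {σ : SignMap (suc k) n} {φ : Vec (Fin n) k → ℕ} {τ : SignMap k n} →
  IsPotential σ φ → DownClosed φ τ → Compatible σ τ
downClosed⇒compatible {σ = σ} pot downClosed Y Y↑ t with σ Y | pot Y Y↑ t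
... | true  | φ↓ = downClosed _ _ φ↓
... | false | φ↑ = λ τ≡false → ¬-not λ τ′≡true →
  contradiction (trans (sym τ≡false) (downClosed _ _ φ↑ τ′≡true)) λ ()

module _ (σ : SignMap r n) (F : Vec (Fin n) r) (s : Sign) where

  update-≡ : update σ F s F ≡ s
  update-≡ with ≡-dec _≟_ F F
  ... | yes _ = refl
  ... | no F≢F = contradiction refl F≢F

  update-≢ : ∀ {v} → v ≢ F → update σ F s v ≡ σ v
  update-≢ {v} v≢F with ≡-dec _≟_ v F
  ... | yes v≡F = contradiction v≡F v≢F
  ... | no _ = refl

update-below-downClosed : (φ : Vec (Fin n) k → ℕ) (I : Vec (Fin n) k) (s : Sign) →
  DownClosed φ (update (below φ (φ I)) I s)
update-below-downClosed φ I s a b φb<φa τa = by-cases (≡-dec _≟_ b I) (≡-dec _≟_ a I)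
  where
  τ = below φ (φ I)
  τa′ : a ≢ I → τ a ≡ true
  τa′ a≢I = trans (sym (update-≢ τ I s a≢I)) τa
  by-cases : Dec (b ≡ I) → Dec (a ≡ I) → update τ I s b ≡ true
  by-cases (yes refl) (yes refl) = contradiction φb<φa (<-irrefl refl)
  by-cases (yes refl) (no a≢I) = contradiction (below⁻ φ (φ I) a (τa′ a≢I)) (<-asym φb<φa)
  by-cases (no b≢I) (yes refl) = trans (update-≢ τ I s b≢I) (below⁺ φ (φ I) φb<φa)
  by-cases (no b≢I) (no a≢I) = trans (update-≢ τ I s b≢I) (below-downClosed φ (φ I) a b φb<φa (τa′ a≢I))

module _ (σ : SignMap (suc k) (suc n)) (I : Vec (Fin n) k) (s : Sign) where

  deletion-update : deletion (update σ (addTop I) s) ≗ deletion σ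
  deletion-update W = update-≢ σ (addTop I) s (inject₁≢addTop W I)

  contraction-update : {τ : SignMap k n} →
    contraction σ ≗ τ → contraction (update σ (addTop I) s) ≗ update τ I s
  contraction-update {τ} σ≗τ Y = by-cases (≡-dec _≟_ Y I)
    where
    by-cases : Dec (Y ≡ I) → contraction (update σ (addTop I) s) Y ≡ update τ I s Y
    by-cases (yes refl) = trans (update-≡ σ (addTop Y) s) (sym (update-≡ τ Y s))
    by-cases (no Y≢I) =
      trans (update-≢ σ (addTop I) s (Y≢I ∘ addTop-injective)) (trans (σ≗τ Y) (sym (update-≢ τ I s Y≢I)))

isSignotope-from-threshold :
  {σ : SignMap (suc k) n} {φ : Vec (Fin n) k → ℕ} {τ : SignMap k n} {σ′ : SignMap (suc k) (suc n)} →
  IsSignotope σ → IsPotential σ φ → DownClosed φ τ →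
  deletion σ′ ≗ σ → contraction σ′ ≗ τ → IsSignotope σ′
isSignotope-from-threshold {φ = φ} {σ′ = σ′} σ-sig pot downClosed σ′≗σ σ′≗τ =
  isSignotope-from-parts {σ = σ′} (IsSignotope-resp-≗ (sym ∘ σ′≗σ) σ-sig)
    (downClosed⇒compatible pot′ downClosed′)
  where
  pot′ : IsPotential (deletion σ′) φ
  pot′ Y Y↑ t =
    subst (λ b → Oriented b (φ (removeAt Y (inject₁ t))) (φ (removeAt Y (suc t)))) (sym (σ′≗σ Y)) (pot Y Y↑ t)
  downClosed′ : DownClosed φ (contraction σ′)
  downClosed′ a b φb<φa e = trans (σ′≗τ b) (downClosed a b φb<φa (trans (sym (σ′≗τ a)) e))

corollary9 : (k n : ℕ) → 1 ≤ k → (σ : SignMap (suc k) n) → IsSignotope σ →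
    (I : Vec (Fin n) k) → Increasing I →
    Σ (SignMap (suc k) (suc n)) λ σ* →
      IsSignotope σ* × IsFliple σ* (addTop I) ×
      ((F : Vec (Fin n) (suc k)) → Increasing F → deletion σ* F ≡ σ F)
corollary9 k n _ σ σ-sig I _ = σ* , σ*-sig , (flipped true , flipped false) , λ F _ → glue-inject₁ F
  where
  φ = proj₁ (potential σ σ-sig)
  φ-pot = proj₂ (proj₂ (potential σ σ-sig))
  τ = below φ (φ I)
  σ* = glue false σ τ

  σ*-sig : IsSignotope σ*
  σ*-sig = isSignotope-from-threshold {σ′ = σ*} σ-sig φ-pot (below-downClosed φ (φ I)) glue-inject₁ glue-addTop

  flipped : ∀ s → IsSignotope (update σ* (addTop I) s)
  flipped s = isSignotope-from-threshold {σ′ = update σ* (addTop I) s} σ-sig φ-pot (update-below-downClosed φ I s)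
    (λ W → trans (deletion-update σ* I s W) (glue-inject₁ W)) (contraction-update σ* I s glue-addTop)
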